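{- Let $G$ be a connected graph and let $\{F_1,\ldots,F_r\}$ be a c-partition of $E(G)$. Then for every two edges $e,f \in E(G)$, $$d_G(e,f)=\sum_{i=1}^r d_{G/F_i}(\alpha_i(e),\alpha_i(f)).$$
   Context: All graphs are finite and simple; $d_G(u,v)$ is the usual shortest-path distance between vertices. For a vertex $v$ and an edge $e=xy$, $d_G(v,e)=\min\{d_G(v,x),d_G(v,y)\}$. For edges $e=xy$, $f=ab$, $d_G(e,f)=\min\{d_G(x,a),d_G(x,b),d_G(y,a),d_G(y,b)\}$. These three notions are applied in any graph (in particular in $G/F_i$) to pairs of vertices/edges. Two edges $e=xy$, $f=ab$ of $G$ are in relation $\Theta$ if $d_G(x,a)+d_G(y,b)\neq d_G(x,b)+d_G(y,a)$; $\Theta^*$ is the transitive closure of $\Theta$, an equivalence relation on $E(G)$, whose classes form the $\Theta^*$-partition. A partition $\{F_1,\ldots,F_r\}$ of $E(G)$ is a c-partition if every $\Theta^*$-class is contained in some $F_i$. For $E'\subseteq E(G)$, the quotient graph $G/E'$ has as vertices the connected components of $G\setminus E'$ (the graph obtained from $G$ by deleting the edges in $E'$), two components $X,Y$ being adjacent iff some vertex of $X$ is adjacent in $G$ to some vertex of $Y$. For each $i$, $\ell_i:V(G)\to V(G/F_i)$ maps $v$ to the component of $G\setminus F_i$ containing $v$, and $\alpha_i:E(G)\to V(G/F_i)\cup E(G/F_i)$ is defined by $\alpha_i(xy)=\ell_i(x)$ if $\ell_i(x)=\ell_i(y)$, and $\alpha_i(xy)=\ell_i(x)\ell_i(y)\in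 E(G/F_i)$ if $\ell_i(x)\neq\ell_i(y)$. -}

module Defs where

open import Data.Nat using (ℕ; zero; suc; _+_; _≤_)
open import Data.Fin using (Fin)
import Data.Fin as Fin
open import Data.Bool using (Bool; true; false)
open import Data.Bool.Properties using () renaming (_≟_ to _≟B_)
open import Data.Fin.Subset using (Subset; _∈_)
open import Data.Vec.Properties using (≡-dec)
open import Data.List using (List; []; _∷_)
open import Data.List.Membership.Propositional using () renaming (_∈_ to _∈ₗ_)
open import Data.Product using (Σ; ∃; ∃-syntax; _×_; _,_)
open import Relation.Binary.PropositionalEquality using (_≡_; _≢_)
open import Relation.Nullary using (¬_; yes; no)
open import Relation.Binary.Construct.Closure.ReflexiveTransitive using (Star)
open import Relation.Binary.Construct.Closure.Transitive using (TransClosure)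
open import Function.Bundles using (_⇔_)

module _ {V : Set} (Adj : V → V → Set) where

  data Walk : V → V → ℕ → Set where
    here  : ∀ {u} → Walk u u 0
    step  : ∀ {u v w k} → Adj u v → Walk v w k → Walk u w (suc k)

  IsDist : V → V → ℕ → Set
  IsDist u v k = Walk u v k × (∀ m → Walk u v m → k ≤ m)

data Obj (V : Set) : Set where
  vtx : V → Obj V
  edg : V → V → Obj V

ends : ∀ {V} → Obj V → List V
ends (vtx v)   = v ∷ []
ends (edg x y) = x ∷ y ∷ []

-- d(A,B) = k : the minimum of d(a,b) over endpoints a of A, b of B
-- (this is d(v,w), d(v,e) = min{d(v,x),d(v,y)} and
--  d(e,f) = min of the four endpoint distances, as in the paper)
IsDistObj : ∀ {V} (Adj : V → V → Set) → Obj V → Obj V → ℕ → Set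
IsDistObj Adj A B k =
  (∃[ a ] ∃[ b ] (a ∈ₗ ends A × b ∈ₗ ends B × IsDist Adj a b k))
  × (∀ a b m → a ∈ₗ ends A → b ∈ₗ ends B → IsDist Adj a b m → k ≤ m)

record Graph (n : ℕ) : Set where
  field
    adj        : Fin n → Fin n → Bool
    adj-sym    : ∀ x y → adj x y ≡ adj y x
    adj-irrefl : ∀ x → adj x x ≡ false

  Adj : Fin n → Fin n → Set
  Adj x y = adj x y ≡ true

open Graph public

Connected : ∀ {n} → Graph n → Set
Connected G = ∀ u v → Star (Adj G) u v

-- (oriented representative of) an edge xy of G
record Edge {n} (G : Graph n) : Set where
  constructor mkEdge
  field
    src tgt : Fin n
    isEdge  : Adj G src tgt

open Edge public

Θ : ∀ {n} (G : Graph n) → Edge G → Edge G → Set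
Θ G (mkEdge x y _) (mkEdge a b _) =
  ∃[ k₁ ] ∃[ k₂ ] ∃[ k₃ ] ∃[ k₄ ]
    ( IsDist (Adj G) x a k₁ × IsDist (Adj G) y b k₂
    × IsDist (Adj G) x b k₃ × IsDist (Adj G) y a k₄
    × (k₁ + k₂) ≢ (k₃ + k₄) )

Θ* : ∀ {n} (G : Graph n) → Edge G → Edge G → Set
Θ* G = TransClosure (Θ G)

-- Partitions {F_1,…,F_r} of E(G), given by a labelling of (unordered)
-- pairs of vertices: the edge xy lies in F_i iff label x y ≡ i.

record EdgePartition {n} (G : Graph n) (r : ℕ) : Set where
  field
    label     : Fin n → Fin n → Fin r
    label-sym : ∀ x y → label x y ≡ label y x

open EdgePartition public

classOf : ∀ {n r} {G : Graph n} → EdgePartition G r → Edge G → Fin r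
classOf P (mkEdge x y _) = label P x y

IsCPartition : ∀ {n r} (G : Graph n) → EdgePartition G r → Set
IsCPartition G P = ∀ e f → Θ* G e f → classOf P e ≡ classOf P f

module _ {n r} (G : Graph n) (P : EdgePartition G r) (i : Fin r) where

  AdjDel : Fin n → Fin n → Set
  AdjDel x y = Adj G x y × label P x y ≢ i

  Reach : Fin n → Fin n → Set
  Reach = Star AdjDel

  IsComponent : Subset n → Set
  IsComponent C = ∃[ v ] (∀ w → (w ∈ C) ⇔ Reach v w)

  -- adjacency of the quotient graph G / F_i.  Vertices are represented by
  -- subsets of V(G); only components carry adjacencies, all other subsets
  -- are isolated and never occur as ℓ_i-images.
  QAdj : Subset n → Subset n → Set
  QAdj X Y = IsComponent X × IsComponent Y × X ≢ Y
           × ∃[ x ] ∃[ y ] (x ∈ X × y ∈ Y × Adj G x y)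

IsLabelling : ∀ {n r} (G : Graph n) (P : EdgePartition G r)
              → (Fin r → Fin n → Subset n) → Set
IsLabelling G P ℓ = ∀ i v w → (w ∈ ℓ i v) ⇔ Reach G P i v w

α : ∀ {n r} {G : Graph n} → (Fin r → Fin n → Subset n)
    → Fin r → Edge G → Obj (Subset n)
α ℓ i (mkEdge x y _) with ≡-dec _≟B_ (ℓ i x) (ℓ i y)
... | yes _ = vtx (ℓ i x)
... | no  _ = edg (ℓ i x) (ℓ i y)

∑ : ∀ {r} → (Fin r → ℕ) → ℕ
∑ {zero}  ks = 0
∑ {suc r} ks = ks Fin.zero + ∑ (λ i → ks (Fin.suc i))

edgeObj : ∀ {n} {G : Graph n} → Edge G → Obj (Fin n)
edgeObj (mkEdge x y _) = edg x y

module Submission where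

-- For vertices u, v and a class F_i, a shortest u–v path has the fewest F_i-edges among all
-- u–v walks.  Indeed δ(xy, st) = d(x,t) + d(y,s) − d(x,s) − d(y,t) vanishes unless xy Θ st,
-- hence unless both edges lie in the same class; summed along any walk from u to v it
-- telescopes to exactly 2 for an edge xy of a shortest path, while summed along a shortest
-- path it is at most 2 for every edge st.  Counting the pairs of F_i-edges weighted by δ in
-- both orders gives 2·(F_i-edges of the path) ≤ 2·(F_i-edges of the walk).
-- Walks of G project onto walks of G/F_i of length at most their number of F_i-edges, and
-- walks of G/F_i lift back, so d_{G/F_i}(ℓ_i u, ℓ_i v) is the number of F_i-edges on a
-- shortest u–v path and d(u,v) = Σ_i d_{G/F_i}(ℓ_i u, ℓ_i v).  For edges e and f the
-- endpoints of e lie in one component of G \ F_i unless F_i is the class of e (likewise for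
-- f), so a single pair of endpoints attains all r minima at once.

open import Defs
open import Algebra.Properties.Semiring.Sum as SemiringSum using ()
open import Data.Bool using (if_then_else_)
open import Data.Bool.Properties using () renaming (_≟_ to _≟B_)
open import Data.Fin using (Fin; zero; suc; _≟_)
open import Data.Fin.Properties using (any?)
open import Data.Fin.Subset using (Subset; _∈_)
open import Data.Fin.Subset.Properties using (⊆-antisym)
open import Data.Integer as ℤ using (ℤ; +_; -_; _-_; _*_; 0ℤ)
import Data.Integer.Properties as ℤₚ
open import Data.Integer.Tactic.RingSolver using (solve-∀)
open import Data.List.Membership.Propositional using () renaming (_∈_ to _∈ₗ_)
open import Data.List.Relation.Unary.Any using (here; there)
open import Data.Nat using (ℕ; zero; suc; _+_; _≤_; z≤n; s≤s)
import Data.Nat.Properties as ℕₚ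
open import Data.Product using (Σ; ∃; ∃-syntax; _×_; _,_; proj₁; proj₂)
open import Data.Vec.Properties using (≡-dec)
open import Function using (_∘_)
open import Function.Bundles using (module Equivalence)
open import Relation.Binary using (Symmetric)
open import Relation.Binary.Construct.Closure.ReflexiveTransitive as Star using (Star; ε; _◅_; _◅◅_)
open import Relation.Binary.Construct.Closure.Transitive using ([_])
open import Relation.Binary.PropositionalEquality
open import Relation.Nullary using (Dec; yes; no; does; contradiction; _×-dec_)

module ℕΣ = SemiringSum ℕₚ.+-*-semiring
module ℤΣ = SemiringSum ℤₚ.+-*-semiring

open Equivalence using (to; from)

∑≡sum : ∀ {r} (ks : Fin r → ℕ) → ∑ ks ≡ ℕΣ.sum ks
∑≡sum {zero}  ks = refl
∑≡sum {suc r} ks = cong (λ s → ks zero + s) (∑≡sum (λ i → ks (suc i)))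

∑-cong : ∀ {r} {f g : Fin r → ℕ} → (∀ i → f i ≡ g i) → ∑ f ≡ ∑ g
∑-cong {zero}  f≗g = refl
∑-cong {suc r} f≗g = cong₂ _+_ (f≗g zero) (∑-cong (λ i → f≗g (suc i)))

∑-mono-≤ : ∀ {r} {f g : Fin r → ℕ} → (∀ i → f i ≤ g i) → ∑ f ≤ ∑ g
∑-mono-≤ {zero}  f≤g = z≤n
∑-mono-≤ {suc r} f≤g = ℕₚ.+-mono-≤ (f≤g zero) (∑-mono-≤ (λ i → f≤g (suc i)))

ℤsum-mono-≤ : ∀ {k} {f g : Fin k → ℤ} → (∀ j → f j ℤ.≤ g j) → ℤΣ.sum f ℤ.≤ ℤΣ.sum g
ℤsum-mono-≤ {zero}  f≤g = ℤₚ.≤-refl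
ℤsum-mono-≤ {suc k} f≤g = ℤₚ.+-mono-≤ (f≤g zero) (ℤsum-mono-≤ (λ j → f≤g (suc j)))

pos-sum : ∀ {k} (a : Fin k → ℕ) → + ℕΣ.sum a ≡ ℤΣ.sum (λ j → + a j)
pos-sum {zero}  a = refl
pos-sum {suc k} a =
  trans (ℤₚ.pos-+ (a zero) _) (cong (λ s → + a zero ℤ.+ s) (pos-sum (λ j → a (suc j))))

pos-suc-minus : ∀ m → + suc m - + m ≡ + 1
pos-suc-minus m rewrite ℤₚ.pos-+ 1 m = cancel (+ m)
  where
  cancel : ∀ x → (+ 1 ℤ.+ x) - x ≡ + 1
  cancel = solve-∀

pos-minus-≤-1 : ∀ {m n} → m ≤ suc n → + m - + n ℤ.≤ + 1
pos-minus-≤-1 {m} {n} m≤1+n =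
  subst (+ m - + n ℤ.≤_) (pos-suc-minus n) (ℤₚ.+-monoˡ-≤ (- + n) (ℤ.+≤+ m≤1+n))

balanced-differences : ∀ a b c e → a + b ≡ c + e → (+ c - + b) - (+ a - + e) ≡ 0ℤ
balanced-differences a b c e a+b≡c+e = begin
  (+ c - + b) - (+ a - + e)      ≡⟨ regroup (+ a) (+ b) (+ c) (+ e) ⟩
  (+ c ℤ.+ + e) - (+ a ℤ.+ + b)  ≡⟨ cong₂ _-_ (ℤₚ.pos-+ c e) (ℤₚ.pos-+ a b) ⟨
  + (c + e) - + (a + b)          ≡⟨ cong (λ t → + (c + e) - + t) a+b≡c+e ⟩
  + (c + e) - + (c + e)          ≡⟨ ℤₚ.+-inverseʳ (+ (c + e)) ⟩
  0ℤ                             ∎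
  where
  open ≡-Reasoning
  regroup : ∀ x y z w → (z - y) - (x - w) ≡ (z ℤ.+ w) - (x ℤ.+ y)
  regroup = solve-∀

double-counting : ∀ {m k} (K : ℕ) (δ : Fin m → Fin k → ℤ) (a : Fin m → ℕ) (b : Fin k → ℕ)
  → (∀ i j → δ i j ≢ 0ℤ → a i ≡ b j)
  → (∀ i → ℤΣ.sum (δ i) ≡ + suc K)
  → (∀ j → ℤΣ.sum (λ i → δ i j) ℤ.≤ + suc K)
  → ℕΣ.sum a ≤ ℕΣ.sum b
double-counting K δ a b compatible rows columns =
  ℤₚ.drop‿+≤+ (ℤₚ.*-cancelʳ-≤-pos (+ ℕΣ.sum a) (+ ℕΣ.sum b) (+ suc K) (begin
    + ℕΣ.sum a * + suc K
      ≡⟨ cong (_* + suc K) (pos-sum a) ⟩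
    ℤΣ.sum A * + suc K
      ≡⟨ ℤΣ.*-distribʳ-sum (+ suc K) A ⟩
    ℤΣ.sum (λ i → A i * + suc K)
      ≡⟨ ℤΣ.sum-cong-≗ (λ i → cong (A i *_) (sym (rows i))) ⟩
    ℤΣ.sum (λ i → A i * ℤΣ.sum (δ i))
      ≡⟨ ℤΣ.sum-cong-≗ (λ i → ℤΣ.*-distribˡ-sum (A i) (δ i)) ⟩
    ℤΣ.sum (λ i → ℤΣ.sum (λ j → A i * δ i j))
      ≡⟨ ℤΣ.sum-cong-≗ (λ i → ℤΣ.sum-cong-≗ (reweigh i)) ⟩
    ℤΣ.sum (λ i → ℤΣ.sum (λ j → B j * δ i j))
      ≡⟨ ℤΣ.∑-comm (λ i j → B j * δ i j) ⟩
    ℤΣ.sum (λ j → ℤΣ.sum (λ i → B j * δ i j))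
      ≡⟨ ℤΣ.sum-cong-≗ (λ j → sym (ℤΣ.*-distribˡ-sum (B j) (λ i → δ i j))) ⟩
    ℤΣ.sum (λ j → B j * ℤΣ.sum (λ i → δ i j))
      ≤⟨ ℤsum-mono-≤ (λ j → ℤₚ.*-monoˡ-≤-nonNeg (B j) (columns j)) ⟩
    ℤΣ.sum (λ j → B j * + suc K)
      ≡⟨ ℤΣ.*-distribʳ-sum (+ suc K) B ⟨
    ℤΣ.sum B * + suc K
      ≡⟨ cong (_* + suc K) (pos-sum b) ⟨
    + ℕΣ.sum b * + suc K ∎))
  where
  open ℤₚ.≤-Reasoning
  A : Fin _ → ℤ
  A i = + a i
  B : Fin _ → ℤ
  B j = + b j
  reweigh : ∀ i j → A i * δ i j ≡ B j * δ i j
  reweigh i j with δ i j ℤ.≟ 0ℤ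
  ... | yes δ≡0 rewrite δ≡0 = trans (ℤₚ.*-zeroʳ (A i)) (sym (ℤₚ.*-zeroʳ (B j)))
  ... | no  δ≢0 = cong (λ c → + c * δ i j) (compatible i j δ≢0)

minimal : {P : ℕ → Set} → (∀ k → Dec (P k))
  → ∀ {m} → P m → ∃[ k ] (P k × (∀ {j} → P j → k ≤ j))
minimal P? p with P? 0
... | yes p₀ = 0 , p₀ , λ _ → z≤n
minimal P? {zero}  p | no ¬p₀ = contradiction p ¬p₀
minimal P? {suc m} p | no ¬p₀ with minimal (λ k → P? (suc k)) p
... | k , pk , least =
  suc k , pk , λ { {zero} p₀ → contradiction p₀ ¬p₀ ; {suc j} pj → s≤s (least pj) }

module _ {V : Set} {R : V → V → Set} where

  infixr 5 _++ʷ_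
  _++ʷ_ : ∀ {u v w a b} → Walk R u v a → Walk R v w b → Walk R u w (a + b)
  here     ++ʷ q = q
  step x p ++ʷ q = step x (p ++ʷ q)

  reverseʷ : Symmetric R → ∀ {u v k} → Walk R u v k → Walk R v u k
  reverseʷ sym here = here
  reverseʷ sym {k = suc k} (step x p) =
    subst (Walk R _ _) (ℕₚ.+-comm k 1) (reverseʷ sym p ++ʷ step (sym x) here)

  fromStar : ∀ {u v} → Star R u v → ∃ (Walk R u v)
  fromStar ε       = 0 , here
  fromStar (x ◅ p) = suc _ , step x (proj₂ (fromStar p))

  isDist-unique : ∀ {u v k m} → IsDist R u v k → IsDist R u v m → k ≡ m
  isDist-unique (p , p-min) (q , q-min) = ℕₚ.≤-antisym (p-min _ q) (q-min _ p)

module _ {n} (G : Graph n) where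

  adj-symmetric : Symmetric (Adj G)
  adj-symmetric {x} {y} xy = trans (adj-sym G y x) xy

  walk? : ∀ k u v → Dec (Walk (Adj G) u v k)
  walk? zero u v with u ≟ v
  ... | yes refl = yes here
  ... | no  u≢v  = no λ { here → u≢v refl }
  walk? (suc k) u v with any? (λ w → (adj G u w ≟B _) ×-dec walk? k w v)
  ... | yes (w , uw , p) = yes (step uw p)
  ... | no  ¬p           = no λ { (step uw p) → ¬p (_ , uw , p) }

  edgeAt : ∀ {u v k} → Walk (Adj G) u v k → Fin k → Edge G
  edgeAt (step uw p) zero    = mkEdge _ _ uw
  edgeAt (step uw p) (suc j) = edgeAt p j

  telescope : (h : Fin n → ℤ) → ∀ {u v k} (p : Walk (Adj G) u v k)
    → ℤΣ.sum (λ j → h (tgt (edgeAt p j)) - h (src (edgeAt p j))) ≡ h v - h u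
  telescope h {u} here = sym (ℤₚ.+-inverseʳ (h u))
  telescope h {u} {v} (step {v = w} uw p) =
    trans (cong (λ s → (h w - h u) ℤ.+ s) (telescope h p)) (chain (h u) (h w) (h v))
    where
    chain : ∀ x y z → (y - x) ℤ.+ (z - y) ≡ z - x
    chain = solve-∀

module Metric {n} (G : Graph n) (connected : Connected G) where

  private
    shortest : ∀ u v → ∃[ k ] (Walk (Adj G) u v k × (∀ {m} → Walk (Adj G) u v m → k ≤ m))
    shortest u v = minimal (λ k → walk? G k u v) (proj₂ (fromStar (connected u v)))

  -- Opaque, so that unification never unfolds the search for a shortest walk.
  opaque
    d : Fin n → Fin n → ℕ
    d u v = proj₁ (shortest u v)

    geodesic : ∀ u v → Walk (Adj G) u v (d u v)
    geodesic u v = proj₁ (proj₂ (shortest u v))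

    d-minimal : ∀ {u v m} → Walk (Adj G) u v m → d u v ≤ m
    d-minimal = proj₂ (proj₂ (shortest _ _))

  isDist : ∀ u v → IsDist (Adj G) u v (d u v)
  isDist u v = geodesic u v , λ _ → d-minimal

  d-refl : ∀ u → d u u ≡ 0
  d-refl u = ℕₚ.n≤0⇒n≡0 (d-minimal {u} here)

  d-sym : ∀ u v → d u v ≡ d v u
  d-sym u v = ℕₚ.≤-antisym (d-minimal (reverseʷ (adj-symmetric G) (geodesic v u)))
                           (d-minimal (reverseʷ (adj-symmetric G) (geodesic u v)))

  d-triangle : ∀ u v w → d u w ≤ d u v + d v w
  d-triangle u v w = d-minimal (geodesic u v ++ʷ geodesic v w)

  d-stepˡ : ∀ {x y} z → Adj G x y → d x z ≤ suc (d y z)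
  d-stepˡ z xy = d-minimal (step xy (geodesic _ z))

  d-stepʳ : ∀ z {x y} → Adj G x y → d z y ≤ suc (d z x)
  d-stepʳ z {x} xy =
    ℕₚ.≤-trans (d-minimal (geodesic z x ++ʷ step xy here)) (ℕₚ.≤-reflexive (ℕₚ.+-comm (d z x) 1))

  Forward : Fin n → Fin n → Edge G → Set
  Forward u v e = d u (tgt e) ≡ suc (d u (src e)) × d (src e) v ≡ suc (d (tgt e) v)

  tight-walk-length : ∀ {u s v m} → Walk (Adj G) s v m → d u s + m ≡ d u v → d s v ≡ m
  tight-walk-length {u} {s} {v} {m} p tight = ℕₚ.≤-antisym (d-minimal p)
    (ℕₚ.+-cancelˡ-≤ (d u s) m (d s v) (subst (_≤ d u s + d s v) (sym tight) (d-triangle u s v)))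

  tight-walk-forward : ∀ {u s v m} (p : Walk (Adj G) s v m) → d u s + m ≡ d u v
    → ∀ j → Forward u v (edgeAt G p j)
  tight-walk-forward {u} {s} {v} (step {v = w} {k = m} sw p) tight = λ where
      zero    → d-u-w , trans (tight-walk-length (step sw p) tight)
                              (cong suc (sym (tight-walk-length p tight′)))
      (suc j) → tight-walk-forward p tight′ j
    where
    open ℕₚ.≤-Reasoning
    d-u-w : d u w ≡ suc (d u s)
    d-u-w = ℕₚ.≤-antisym (d-stepʳ u sw) (ℕₚ.+-cancelʳ-≤ m _ _ (begin
      suc (d u s) + m  ≡⟨ ℕₚ.+-suc (d u s) m ⟨
      d u s + suc m    ≡⟨ tight ⟩
      d u v            ≤⟨ d-triangle u w v ⟩
      d u w + d w v    ≤⟨ ℕₚ.+-monoʳ-≤ (d u w) (d-minimal p) ⟩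
      d u w + m        ∎))
    tight′ : d u w + m ≡ d u v
    tight′ = trans (cong (_+ m) d-u-w) (trans (sym (ℕₚ.+-suc (d u s) m)) tight)

  geodesic-forward : ∀ u v j → Forward u v (edgeAt G (geodesic u v) j)
  geodesic-forward u v = tight-walk-forward (geodesic u v) (cong (_+ d u v) (d-refl u))

  φ : Edge G → Fin n → ℤ
  φ e z = + d (src e) z - + d (tgt e) z

  δ : Edge G → Edge G → ℤ
  δ e g = φ e (tgt g) - φ e (src g)

  φ-forward : ∀ {u v} e → Forward u v e → φ e v - φ e u ≡ + 2
  φ-forward {u} {v} (mkEdge x y _) (d-u-y , d-x-v) = begin
    (+ d x v - + d y v) - (+ d x u - + d y u)
      ≡⟨ cong₂ (λ p q → (+ p - + d y v) - (+ d x u - + q)) d-x-v d-y-u ⟩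
    (+ suc (d y v) - + d y v) - (+ d x u - + suc (d x u))
      ≡⟨ cong₂ (λ p q → p - (+ d x u - q)) (pos-suc-minus (d y v)) (ℤₚ.pos-+ 1 (d x u)) ⟩
    + 1 - (+ d x u - (+ 1 ℤ.+ + d x u))
      ≡⟨ two (+ d x u) ⟩
    + 2 ∎
    where
    open ≡-Reasoning
    d-y-u : d y u ≡ suc (d x u)
    d-y-u = trans (d-sym y u) (trans d-u-y (cong suc (d-sym u x)))
    two : ∀ a → + 1 - (a - (+ 1 ℤ.+ a)) ≡ + 2
    two = solve-∀

  φ-difference-≤-2 : ∀ e u v → φ e v - φ e u ℤ.≤ + 2
  φ-difference-≤-2 (mkEdge x y xy) u v =
    subst (ℤ._≤ + 2) (sym (regroup (+ d x v) (+ d y v) (+ d x u) (+ d y u)))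
    (ℤₚ.+-mono-≤ (pos-minus-≤-1 (d-stepˡ v xy)) (pos-minus-≤-1 (d-stepˡ u (adj-symmetric G xy))))
    where
    regroup : ∀ a b c e → (a - b) - (c - e) ≡ (a - b) ℤ.+ (e - c)
    regroup = solve-∀

  δ-sym : ∀ e g → δ e g ≡ δ g e
  δ-sym (mkEdge x y _) (mkEdge s t _)
    rewrite d-sym s y | d-sym t y | d-sym s x | d-sym t x =
      regroup (+ d x t) (+ d y t) (+ d x s) (+ d y s)
    where
    regroup : ∀ a b c e → (a - b) - (c - e) ≡ (e - b) - (c - a)
    regroup = solve-∀

  δ≢0⇒Θ : ∀ e g → δ e g ≢ 0ℤ → Θ G e g
  δ≢0⇒Θ (mkEdge x y _) (mkEdge s t _) δ≢0 =
    d x s , d y t , d x t , d y s , isDist x s , isDist y t , isDist x t , isDist y s ,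
    δ≢0 ∘ balanced-differences (d x s) (d y t) (d x t) (d y s)

χ : ∀ {r} → Fin r → Fin r → ℕ
χ c i = if does (c ≟ i) then 1 else 0

χ-≢ : ∀ {r} {c i : Fin r} → c ≢ i → χ c i ≡ 0
χ-≢ {c = c} {i} c≢i with c ≟ i
... | yes c≡i = contradiction c≡i c≢i
... | no  _   = refl

χ-≤-1 : ∀ {r} (c i : Fin r) → χ c i ≤ 1
χ-≤-1 c i with c ≟ i
... | yes _ = ℕₚ.≤-refl
... | no  _ = z≤n

χ-≡ : ∀ {r} {c i : Fin r} → c ≡ i → χ c i ≡ 1
χ-≡ {c = c} {i} c≡i with c ≟ i
... | yes _   = refl
... | no  c≢i = contradiction c≡i c≢i

-- does (suc c ≟ suc i) reduces to does (c ≟ i), so the successor case holds definitionally.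
∑-χ : ∀ {r} (c : Fin r) → ℕΣ.sum (χ c) ≡ 1
∑-χ {suc r} zero    = cong suc (ℕΣ.sum-replicate-zero r)
∑-χ         (suc c) = ∑-χ c

module _ {n r} {G : Graph n} (P : EdgePartition G r) where

  count : Fin r → ∀ {u v k} → Walk (Adj G) u v k → ℕ
  count i p = ℕΣ.sum (λ j → χ (classOf P (edgeAt G p j)) i)

  count-++ : ∀ i {u v w a b} (p : Walk (Adj G) u v a) (q : Walk (Adj G) v w b)
    → count i (p ++ʷ q) ≡ count i p + count i q
  count-++ i here                q = refl
  count-++ i (step {u} {w} uw p) q =
    trans (cong (λ t → χ (label P u w) i + t) (count-++ i p q))
          (sym (ℕₚ.+-assoc (χ (label P u w) i) (count i p) (count i q)))

  ∑-count : ∀ {u v k} (p : Walk (Adj G) u v k) → ℕΣ.sum (λ i → count i p) ≡ k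
  ∑-count here = ℕΣ.sum-replicate-zero r
  ∑-count (step {u} {w} uw p) =
    trans (ℕΣ.∑-distrib-+ (χ (label P u w)) (λ i → count i p))
          (cong₂ _+_ (∑-χ (label P u w)) (∑-count p))

module _ {n r} (G : Graph n) (connected : Connected G)
         (P : EdgePartition G r) (c-partition : IsCPartition G P) where
  open Metric G connected

  geodesic-count-minimal : ∀ i {u v m} (p : Walk (Adj G) u v m) → count P i (geodesic u v) ≤ count P i p
  geodesic-count-minimal i {u} {v} p =
    double-counting 1 (λ j j′ → δ (γ j) (η j′)) (weight ∘ γ) (weight ∘ η) same-class row column
    where
    γ : Fin (d u v) → Edge G
    γ = edgeAt G (geodesic u v)
    η : Fin _ → Edge G
    η = edgeAt G p
    weight : Edge G → ℕ
    weight e = χ (classOf P e) i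
    same-class : ∀ j j′ → δ (γ j) (η j′) ≢ 0ℤ → weight (γ j) ≡ weight (η j′)
    same-class j j′ δ≢0 =
      cong (λ c → χ c i) (c-partition (γ j) (η j′) [ δ≢0⇒Θ (γ j) (η j′) δ≢0 ])
    row : ∀ j → ℤΣ.sum (λ j′ → δ (γ j) (η j′)) ≡ + 2
    row j = trans (telescope G (φ (γ j)) p) (φ-forward (γ j) (geodesic-forward u v j))
    column : ∀ j′ → ℤΣ.sum (λ j → δ (γ j) (η j′)) ℤ.≤ + 2
    column j′ = subst (ℤ._≤ + 2)
      (sym (trans (ℤΣ.sum-cong-≗ (λ j → δ-sym (γ j) (η j′)))
                  (telescope G (φ (η j′)) (geodesic u v))))
      (φ-difference-≤-2 (η j′) u v)

module Quotient {n r} {G : Graph n} (P : EdgePartition G r)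
                {ℓ : Fin r → Fin n → Subset n} (labelling : IsLabelling G P ℓ) (i : Fin r) where

  adjDel-symmetric : Symmetric (AdjDel G P i)
  adjDel-symmetric {x} {y} (xy , label≢i) = adj-symmetric G xy , label≢i ∘ trans (label-sym P x y)

  ∈-ℓ : ∀ v → v ∈ ℓ i v
  ∈-ℓ v = from (labelling i v v) ε

  ℓ-isComponent : ∀ v → IsComponent G P i (ℓ i v)
  ℓ-isComponent v = v , labelling i v

  ℓ-cong : ∀ {x y} → AdjDel G P i x y → ℓ i x ≡ ℓ i y
  ℓ-cong {x} {y} xy = ⊆-antisym
    (λ w∈ℓx → from (labelling i y _) (adjDel-symmetric xy ◅ to (labelling i x _) w∈ℓx))
    (λ w∈ℓy → from (labelling i x _) (xy ◅ to (labelling i y _) w∈ℓy))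

  crossing-edge-label : ∀ {x y} → Adj G x y → ℓ i x ≢ ℓ i y → label P x y ≡ i
  crossing-edge-label {x} {y} xy ℓx≢ℓy with label P x y ≟ i
  ... | yes label≡i = label≡i
  ... | no  label≢i = contradiction (ℓ-cong (xy , label≢i)) ℓx≢ℓy

  component-reach : ∀ {X s t} → IsComponent G P i X → s ∈ X → t ∈ X → Reach G P i s t
  component-reach (v , X≡reach) s∈X t∈X =
    Star.reverse adjDel-symmetric (to (X≡reach _) s∈X) ◅◅ to (X≡reach _) t∈X

  reach⇒walk : ∀ {s t} → Reach G P i s t → ∃[ k ] Σ (Walk (Adj G) s t k) (λ p → count P i p ≡ 0)
  reach⇒walk ε = 0 , here , refl
  reach⇒walk ((st , label≢i) ◅ reach) with reach⇒walk reach
  ... | k , p , count≡0 = suc k , step st p , cong₂ _+_ (χ-≢ label≢i) count≡0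

  project : ∀ {s t k} (p : Walk (Adj G) s t k)
    → ∃[ j ] (Walk (QAdj G P i) (ℓ i s) (ℓ i t) j × j ≤ count P i p)
  project here = 0 , here , z≤n
  project {s} {t} (step {v = w} sw p) with project p | ≡-dec _≟B_ (ℓ i s) (ℓ i w)
  ... | j , q , j≤count | yes ℓs≡ℓw =
    j , subst (λ X → Walk (QAdj G P i) X (ℓ i t) j) (sym ℓs≡ℓw) q ,
    ℕₚ.≤-trans j≤count (ℕₚ.m≤n+m (count P i p) (χ (label P s w) i))
  ... | j , q , j≤count | no ℓs≢ℓw =
    suc j , step (ℓ-isComponent s , ℓ-isComponent w , ℓs≢ℓw , s , w , ∈-ℓ s , ∈-ℓ w , sw) q ,
    subst (λ c → suc j ≤ c + count P i p) (sym (χ-≡ (crossing-edge-label sw ℓs≢ℓw))) (s≤s j≤count)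

  lift : ∀ {X Y j} → Walk (QAdj G P i) X Y j → IsComponent G P i X
    → ∀ {s t} → s ∈ X → t ∈ Y → ∃[ m ] Σ (Walk (Adj G) s t m) (λ p → count P i p ≤ j)
  lift here X-component s∈X t∈X with reach⇒walk (component-reach X-component s∈X t∈X)
  ... | m , p , count≡0 = m , p , ℕₚ.≤-reflexive count≡0
  lift {j = suc j} (step (_ , Z-component , _ , x , z , x∈X , z∈Z , xz) q) X-component s∈X t∈Y
    with reach⇒walk (component-reach X-component s∈X x∈X) | lift q Z-component z∈Z t∈Y
  ... | _ , p₁ , count₁≡0 | _ , p₂ , count₂≤j = _ , p₁ ++ʷ step xz p₂ , (begin
    count P i (p₁ ++ʷ step xz p₂)                      ≡⟨ count-++ P i p₁ (step xz p₂) ⟩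
    count P i p₁ + (χ (label P x z) i + count P i p₂)  ≡⟨ cong (_+ _) count₁≡0 ⟩
    χ (label P x z) i + count P i p₂                   ≤⟨ ℕₚ.+-mono-≤ (χ-≤-1 (label P x z) i) count₂≤j ⟩
    suc j                                              ∎)
    where open ℕₚ.≤-Reasoning

  ends-same-component : ∀ e → classOf P e ≢ i
    → ∀ {p p′} → p ∈ₗ ends (edgeObj e) → p′ ∈ₗ ends (edgeObj e) → ℓ i p ≡ ℓ i p′
  ends-same-component (mkEdge x y xy) label≢i = λ where
    (here refl)         (here refl)         → refl
    (here refl)         (there (here refl)) → ℓ-cong (xy , label≢i)
    (there (here refl)) (here refl)         → sym (ℓ-cong (xy , label≢i))
    (there (here refl)) (there (here refl)) → refl

module _ {n r} {G : Graph n} (ℓ : Fin r → Fin n → Subset n) (i : Fin r) where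

  α-ends : ∀ e {p} → p ∈ₗ ends (edgeObj e) → ℓ i p ∈ₗ ends (α {G = G} ℓ i e)
  α-ends (mkEdge x y _) p∈ with ≡-dec _≟B_ (ℓ i x) (ℓ i y) | p∈
  ... | yes _      | here refl         = here refl
  ... | yes ℓx≡ℓy  | there (here refl) = here (sym ℓx≡ℓy)
  ... | no  _      | here refl         = here refl
  ... | no  _      | there (here refl) = there (here refl)

  α-ends⁻ : ∀ e {A} → A ∈ₗ ends (α {G = G} ℓ i e) → ∃[ p ] (p ∈ₗ ends (edgeObj e) × A ≡ ℓ i p)
  α-ends⁻ (mkEdge x y _) A∈ with ≡-dec _≟B_ (ℓ i x) (ℓ i y) | A∈
  ... | yes _ | here refl         = x , here refl , refl
  ... | no  _ | here refl         = x , here refl , refl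
  ... | no  _ | there (here refl) = y , there (here refl) , refl

record IsMinOver {V : Set} (D : V → V → ℕ) (A B : Obj V) (κ : ℕ) : Set where
  field
    {argminˡ argminʳ} : V
    argminˡ∈ : argminˡ ∈ₗ ends A
    argminʳ∈ : argminʳ ∈ₗ ends B
    attained : κ ≡ D argminˡ argminʳ
    least    : ∀ {a b} → a ∈ₗ ends A → b ∈ₗ ends B → κ ≤ D a b

open IsMinOver

isDistObj⇒isMinOver : ∀ {V} {R : V → V → Set} {D : V → V → ℕ} → (∀ a b → IsDist R a b (D a b))
  → ∀ {A B κ} → IsDistObj R A B κ → IsMinOver D A B κ
isDistObj⇒isMinOver D-isDist ((a , b , a∈ , b∈ , κ-isDist) , κ-least) = record
  { argminˡ∈ = a∈
  ; argminʳ∈ = b∈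
  ; attained = isDist-unique κ-isDist (D-isDist a b)
  ; least    = λ a∈ b∈ → κ-least _ _ _ a∈ b∈ (D-isDist _ _)
  }

-- One pair of endpoints minimises every summand at once.
sum-of-minima : ∀ {V : Set} {r} {A B : Obj V} (c : Fin r → V → V → ℕ) (iᴬ iᴮ : Fin r)
  → (∀ i → iᴬ ≢ i → ∀ {a a′} → a ∈ₗ ends A → a′ ∈ₗ ends A → ∀ b → c i a b ≡ c i a′ b)
  → (∀ i → iᴮ ≢ i → ∀ a {b b′} → b ∈ₗ ends B → b′ ∈ₗ ends B → c i a b ≡ c i a b′)
  → ∀ {k ks} → IsMinOver (λ a b → ∑ (λ i → c i a b)) A B k → (∀ i → IsMinOver (c i) A B (ks i))
  → k ≡ ∑ ks
sum-of-minima c iᴬ iᴮ independentᴬ independentᴮ {k} {ks} k-min ks-min = ℕₚ.≤-antisym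
  (ℕₚ.≤-trans (least k-min (argminˡ∈ (ks-min iᴬ)) (argminʳ∈ (ks-min iᴮ)))
              (ℕₚ.≤-reflexive (∑-cong pq-attains)))
  (ℕₚ.≤-trans (∑-mono-≤ (λ i → least (ks-min i) (argminˡ∈ k-min) (argminʳ∈ k-min)))
              (ℕₚ.≤-reflexive (sym (attained k-min))))
  where
  p = argminˡ (ks-min iᴬ)
  q = argminʳ (ks-min iᴮ)
  moveˡ : ∀ i → c i p q ≡ c i (argminˡ (ks-min i)) q
  moveˡ i with iᴬ ≟ i
  ... | yes refl = refl
  ... | no  iᴬ≢i = independentᴬ i iᴬ≢i (argminˡ∈ (ks-min iᴬ)) (argminˡ∈ (ks-min i)) q
  moveʳ : ∀ i a → c i a q ≡ c i a (argminʳ (ks-min i))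
  moveʳ i a with iᴮ ≟ i
  ... | yes refl = refl
  ... | no  iᴮ≢i = independentᴮ i iᴮ≢i a (argminʳ∈ (ks-min iᴮ)) (argminʳ∈ (ks-min i))
  pq-attains : ∀ i → c i p q ≡ ks i
  pq-attains i = trans (moveˡ i) (trans (moveʳ i _) (sym (attained (ks-min i))))

module Decomposition {n r} (G : Graph n) (connected : Connected G)
                     (P : EdgePartition G r) (c-partition : IsCPartition G P)
                     {ℓ : Fin r → Fin n → Subset n} (labelling : IsLabelling G P ℓ) where
  open Metric G connected
  open Quotient P labelling

  classDist : Fin r → Fin n → Fin n → ℕ
  classDist i u v = count P i (geodesic u v)

  d≡∑classDist : ∀ u v → d u v ≡ ∑ (λ i → classDist i u v)
  d≡∑classDist u v = sym (trans (∑≡sum (λ i → classDist i u v)) (∑-count P (geodesic u v)))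

  quotient-isDist : ∀ i u v → IsDist (QAdj G P i) (ℓ i u) (ℓ i v) (classDist i u v)
  quotient-isDist i u v with project i (geodesic u v)
  ... | j , q , j≤ =
    subst (Walk (QAdj G P i) (ℓ i u) (ℓ i v)) (ℕₚ.≤-antisym j≤ (below j q)) q , below
    where
    below : ∀ m → Walk (QAdj G P i) (ℓ i u) (ℓ i v) m → classDist i u v ≤ m
    below m q with lift i q (ℓ-isComponent i u) (∈-ℓ i u) (∈-ℓ i v)
    ... | _ , p , count≤m = ℕₚ.≤-trans (geodesic-count-minimal G connected P c-partition i p) count≤m

  classDist-cong : ∀ i {p p′ q q′} → ℓ i p ≡ ℓ i p′ → ℓ i q ≡ ℓ i q′
    → classDist i p q ≡ classDist i p′ q′
  classDist-cong i {p} {p′} {q} {q′} ℓp≡ℓp′ ℓq≡ℓq′ = isDist-unique (quotient-isDist i p q)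
    (subst₂ (λ X Y → IsDist (QAdj G P i) X Y (classDist i p′ q′)) (sym ℓp≡ℓp′) (sym ℓq≡ℓq′)
            (quotient-isDist i p′ q′))

  quotient-isMinOver : ∀ i (e f : Edge G) {κ} → IsDistObj (QAdj G P i) (α ℓ i e) (α ℓ i f) κ
    → IsMinOver (classDist i) (edgeObj e) (edgeObj f) κ
  quotient-isMinOver i e f ((A , B , A∈ , B∈ , κ-isDist) , κ-least)
    with α-ends⁻ ℓ i e A∈ | α-ends⁻ ℓ i f B∈
  ... | p , p∈ , refl | q , q∈ , refl = record
    { argminˡ∈ = p∈
    ; argminʳ∈ = q∈
    ; attained = isDist-unique κ-isDist (quotient-isDist i p q)
    ; least    = λ a∈ b∈ →
        κ-least _ _ _ (α-ends ℓ i e a∈) (α-ends ℓ i f b∈) (quotient-isDist i _ _)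
    }

theorem3p2 : ∀ {n r} (G : Graph n) → Connected G
    → (P : EdgePartition G r) → IsCPartition G P
    → (ℓ : Fin r → Fin n → Subset n) → IsLabelling G P ℓ
    → (e f : Edge G) (k : ℕ) (ks : Fin r → ℕ)
    → IsDistObj (Adj G) (edgeObj e) (edgeObj f) k
    → (∀ i → IsDistObj (QAdj G P i) (α ℓ i e) (α ℓ i f) (ks i))
    → k ≡ ∑ ks
theorem3p2 G connected P c-partition ℓ labelling e f k ks k-isDist ks-isDist =
  sum-of-minima classDist (classOf P e) (classOf P f)
    (λ i e≢i a∈ a′∈ b → classDist-cong i (ends-same-component i e e≢i a∈ a′∈) refl)
    (λ i f≢i a b∈ b′∈ → classDist-cong i refl (ends-same-component i f f≢i b∈ b′∈))
    (isDistObj⇒isMinOver (λ a b → subst (IsDist (Adj G) a b) (d≡∑classDist a b) (isDist a b))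
                         k-isDist)
    (λ i → quotient-isMinOver i e f (ks-isDist i))
  where
  open Metric G connected
  open Quotient P labelling
  open Decomposition G connected P c-partition labelling
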